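{- Let $n\geq 7$ and let $C=(a_1,a_2,\dots,a_m)$ be a cycle in the Fibonacci-sum graph $G_n$. Then there do not exist indices $1\leq i<j<k<\ell\leq m$ such that both $\{a_i,a_k\}$ and $\{a_j,a_\ell\}$ are edges of $G_n$; that is, $C$ has no crossing chords.
   Context: The Fibonacci numbers are defined by $F_0=0$, $F_1=1$ and $F_m=F_{m-1}+F_{m-2}$ for $m\geq 2$. For each integer $n\geq 1$, the Fibonacci-sum graph $G_n$ is the simple graph with vertex set $\{1,2,\dots,n\}$ in which distinct vertices $i,j$ are adjacent if and only if $i+j$ is a Fibonacci number. -}

module Defs where

open import Data.Nat using (ℕ; zero; suc; _+_; _≤_; _<_)
open import Data.Fin using (Fin; toℕ)
open import Data.Product using (∃; _×_)
open import Relation.Binary.PropositionalEquality using (_≡_; _≢_)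

fib : ℕ → ℕ
fib zero = zero
fib (suc zero) = suc zero
fib (suc (suc m)) = fib (suc m) + fib m

IsFib : ℕ → Set
IsFib k = ∃ λ t → fib t ≡ k

Adj : ℕ → ℕ → ℕ → Set
Adj n x y = (1 ≤ x × x ≤ n) × (1 ≤ y × y ≤ n) × x ≢ y × IsFib (x + y)

-- A cycle (a_1,…,a_m) in G_n, indexed by Fin m (a_1 is index 0):
-- m ≥ 3, vertices pairwise distinct, consecutive vertices adjacent,
-- and the last vertex adjacent to the first.
record IsCycle (n m : ℕ) (a : Fin m → ℕ) : Set where
  field
    length≥3  : 3 ≤ m
    distinct  : ∀ (i j : Fin m) → a i ≡ a j → i ≡ j
    consec    : ∀ (i j : Fin m) → suc (toℕ i) ≡ toℕ j → Adj n (a i) (a j)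
    closing   : ∀ (i j : Fin m) → suc (toℕ i) ≡ m → toℕ j ≡ 0 → Adj n (a i) (a j)

-- Call a symmetric relation R on ℕ 2-simplicial if the positive R-neighbours
-- of any t below t are pairwise related and at most two in number.  Then no
-- R-cycle with distinct positive labels has crossing chords: rotate the
-- largest label to the last position; if that vertex ends a chord it has
-- three smaller neighbours, otherwise its two cycle neighbours are related,
-- so deleting it keeps both chords, and we induct on the largest label.
-- Fibonacci-sum adjacency becomes 2-simplicial once enlarged by the "gap"
-- edges x ~ x + F(k) that deletion creates (FibRel); both conditions follow
-- from the fact that (t, 2t) holds at most two Fibonacci numbers, and two only
-- when consecutive.

module Submission where

open import Data.Nat using (ℕ; zero; suc; _+_; _≤_; _<_; _≤′_; z≤n; s≤s; s≤s⁻¹; z<s; ≤′-refl; ≤′-step)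
open import Data.Nat.Properties
open import Data.Fin using (Fin; toℕ; fromℕ<) renaming (_<_ to _<ᶠ_)
open import Data.Fin.Properties using (toℕ-fromℕ<; fromℕ<-toℕ; fromℕ<-cong; toℕ<n)
open import Data.Product using (∃; _×_; _,_; proj₁; proj₂)
open import Data.Sum using (_⊎_; inj₁; inj₂)
open import Data.Empty using (⊥)
open import Function using (_∘_)
open import Relation.Nullary using (¬_; yes; no; contradiction)
open import Relation.Binary using (tri<; tri≈; tri>)
open import Relation.Binary.PropositionalEquality
  using (_≡_; _≢_; refl; sym; trans; cong; subst; subst₂; module ≡-Reasoning)

open import Defs

open ≡-Reasoning

-- (1) 2-simplicial relations and cycles

Below : ℕ → ℕ → Set
Below t y = 0 < y × y < t

record TwoSimplicial (R : ℕ → ℕ → Set) : Set where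
  field
    symmetric         : ∀ {x y} → R x y → R y x
    lower-adjacent    : ∀ {t y₁ y₂} → Below t y₁ → Below t y₂ → y₁ ≢ y₂ →
                        R t y₁ → R t y₂ → R y₁ y₂
    lower-at-most-two : ∀ {t y₁ y₂ y₃} → Below t y₁ → Below t y₂ → Below t y₃ →
                        y₁ ≢ y₂ → y₁ ≢ y₃ → y₂ ≢ y₃ → R t y₁ → R t y₂ → R t y₃ → ⊥

rotate : ℕ → (ℕ → ℕ) → ℕ → ℕ
rotate m v p with suc p <? m
... | yes _ = v (suc p)
... | no _  = v 0

rotate-inner : ∀ {m v p} → suc p < m → rotate m v p ≡ v (suc p)
rotate-inner {m} {v} {p} 1+p<m with suc p <? m
... | yes _     = refl
... | no 1+p≮m = contradiction 1+p<m 1+p≮m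

rotate-last : ∀ {m v p} → suc p ≡ m → rotate m v p ≡ v 0
rotate-last {m} {v} {p} 1+p≡m with suc p <? m
... | yes 1+p<m = contradiction 1+p≡m (<⇒≢ 1+p<m)
... | no _      = refl

rotate-label : ∀ {m v p} → p < m → ∃ λ q → q < m × rotate m v p ≡ v q
rotate-label {p = p} p<m with m≤n⇒m<n∨m≡n p<m
... | inj₁ 1+p<m = suc p , 1+p<m , rotate-inner 1+p<m
... | inj₂ 1+p≡m = 0 , ≤-<-trans z≤n p<m , rotate-last 1+p≡m

module Elimination {R : ℕ → ℕ → Set} (R-simplicial : TwoSimplicial R) where
  open TwoSimplicial R-simplicial

  record Cycle (m : ℕ) (v : ℕ → ℕ) : Set where
    field
      positive  : ∀ {p} → p < m → 0 < v p
      injective : ∀ {p q} → p < m → q < m → v p ≡ v q → p ≡ q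
      step      : ∀ {p} → suc p < m → R (v p) (v (suc p))
      closing   : ∀ {p} → suc p ≡ m → R (v p) (v 0)
  open Cycle

  record Crossing (m : ℕ) (v : ℕ → ℕ) : Set where
    constructor crossing
    field
      {i j k l} : ℕ
      i<j    : i < j
      j<k    : j < k
      k<l    : k < l
      l<m    : l < m
      chord₁ : R (v i) (v k)
      chord₂ : R (v j) (v l)

  Bounded : ℕ → (ℕ → ℕ) → ℕ → Set
  Bounded m v t = ∀ {p} → p < m → v p ≤ t

  R-resp : ∀ {x x′ y y′} → x ≡ x′ → y ≡ y′ → R x′ y′ → R x y
  R-resp x≡x′ y≡y′ = subst₂ R (sym x≡x′) (sym y≡y′)

  rotate-cycle : ∀ {m v} → Cycle m v → Cycle m (rotate m v)
  rotate-cycle {m} {v} c = record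
    { positive  = positive′
    ; injective = injective′
    ; step      = step′
    ; closing   = closing′
    }
    where
    positive′ : ∀ {p} → p < m → 0 < rotate m v p
    positive′ p<m with rotate-label p<m
    ... | q , q<m , e = subst (0 <_) (sym e) (positive c q<m)

    injective′ : ∀ {p q} → p < m → q < m → rotate m v p ≡ rotate m v q → p ≡ q
    injective′ {p} {q} p<m q<m e with m≤n⇒m<n∨m≡n p<m | m≤n⇒m<n∨m≡n q<m
    ... | inj₁ 1+p<m | inj₁ 1+q<m = suc-injective (injective c 1+p<m 1+q<m (begin
      v (suc p)     ≡⟨ sym (rotate-inner 1+p<m) ⟩
      rotate m v p  ≡⟨ e ⟩
      rotate m v q  ≡⟨ rotate-inner 1+q<m ⟩
      v (suc q)     ∎))
    ... | inj₂ 1+p≡m | inj₂ 1+q≡m = suc-injective (trans 1+p≡m (sym 1+q≡m))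
    ... | inj₁ 1+p<m | inj₂ 1+q≡m = contradiction
      (injective c 1+p<m (≤-<-trans z≤n q<m)
        (trans (sym (rotate-inner 1+p<m)) (trans e (rotate-last 1+q≡m)))) λ ()
    ... | inj₂ 1+p≡m | inj₁ 1+q<m = contradiction
      (injective c 1+q<m (≤-<-trans z≤n p<m)
        (trans (sym (rotate-inner 1+q<m)) (trans (sym e) (rotate-last 1+p≡m)))) λ ()

    step′ : ∀ {p} → suc p < m → R (rotate m v p) (rotate m v (suc p))
    step′ 1+p<m with m≤n⇒m<n∨m≡n 1+p<m
    ... | inj₁ 2+p<m = R-resp (rotate-inner 1+p<m) (rotate-inner 2+p<m) (step c 2+p<m)
    ... | inj₂ 2+p≡m = R-resp (rotate-inner 1+p<m) (rotate-last 2+p≡m) (closing c 2+p≡m)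

    closing′ : ∀ {p} → suc p ≡ m → R (rotate m v p) (rotate m v 0)
    closing′ 1+p≡m with m≤n⇒m<n∨m≡n (subst (0 <_) 1+p≡m z<s)
    ... | inj₁ 1<m = R-resp (rotate-last 1+p≡m) (rotate-inner 1<m) (step c 1<m)
    ... | inj₂ 1≡m = R-resp (rotate-last 1+p≡m) (rotate-last 1≡m) (closing c 1≡m)

  rotate-bounded : ∀ {m v t} → Bounded m v t → Bounded m (rotate m v) t
  rotate-bounded bd p<m with rotate-label p<m
  ... | q , q<m , e = subst (_≤ _) (sym e) (bd q<m)

  -- Rotation keeps crossing chords; when position 0 wraps round to the end,
  -- the two chords exchange their roles.
  rotate-crossing : ∀ {m v} → Crossing m v → Crossing m (rotate m v)
  rotate-crossing {m} {v} (crossing {suc i} {_} {_} {suc l} (s≤s i<j) (s≤s j<k) (s≤s k<l) l<m c₁ c₂) =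
    crossing i<j j<k k<l (<-trans (n<1+n l) l<m)
      (R-resp (shift (<⇒≤ (<-trans (<-trans i<j j<k) k<l))) (shift (<⇒≤ k<l)) c₁)
      (R-resp (shift (<⇒≤ (<-trans j<k k<l))) (shift ≤-refl) c₂)
    where
    shift : ∀ {p} → p ≤ l → rotate m v p ≡ v (suc p)
    shift p≤l = rotate-inner (≤-<-trans (s≤s p≤l) l<m)
  rotate-crossing {suc m} {v} (crossing {zero} {_} {_} {suc l} (s≤s z≤n) (s≤s j<k) (s≤s k<l) (s≤s l<m) c₁ c₂) =
    crossing j<k k<l l<m (n<1+n m)
      (R-resp (shift (<⇒≤ (<-trans j<k k<l))) (shift ≤-refl) c₂)
      (R-resp (shift (<⇒≤ k<l)) (rotate-last {p = m} refl) (symmetric c₁))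
    where
    shift : ∀ {p} → p ≤ l → rotate (suc m) v p ≡ v (suc p)
    shift p≤l = rotate-inner (s≤s (≤-<-trans p≤l l<m))

  LastOnTop : ℕ → (ℕ → ℕ) → Set
  LastOnTop m v = ∀ {q} → q < m → v q < v m

  below-last : ∀ {m v q} → Cycle (suc m) v → LastOnTop m v → q < m → Below (v m) (v q)
  below-last c top q<m = positive c (m<n⇒m<1+n q<m) , top q<m

  labels-distinct : ∀ {m v p q} → Cycle m v → p < m → q < m → p ≢ q → v p ≢ v q
  labels-distinct c p<m q<m p≢q = p≢q ∘ injective c p<m q<m

  last-is-top : ∀ {m v t} → Cycle (suc m) v → Bounded (suc m) v (suc t) → v m ≡ suc t →
                LastOnTop m v
  last-is-top {m} {v} c bd vm≡ {q} q<m = ≤∧≢⇒< vq≤vm vq≢vm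
    where
    vq≤vm : v q ≤ v m
    vq≤vm = subst (v q ≤_) (sym vm≡) (bd (m<n⇒m<1+n q<m))
    vq≢vm : v q ≢ v m
    vq≢vm = labels-distinct c (m<n⇒m<1+n q<m) (n<1+n m) (<⇒≢ q<m)

  -- Deleting the largest (last) vertex: its cycle neighbours v (m-1) and v 0
  -- are distinct smaller neighbours of it, hence R-related, which closes the
  -- shorter cycle.
  delete-last : ∀ {m v} → Cycle (suc m) v → LastOnTop m v → 2 ≤ m → Cycle m v
  delete-last {m} {v} c top 2≤m = record
    { positive  = positive c ∘ m<n⇒m<1+n
    ; injective = λ p<m q<m → injective c (m<n⇒m<1+n p<m) (m<n⇒m<1+n q<m)
    ; step      = step c ∘ m<n⇒m<1+n
    ; closing   = closing′
    }
    where
    closing′ : ∀ {p} → suc p ≡ m → R (v p) (v 0)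
    closing′ {p} 1+p≡m =
      lower-adjacent (below-last c top p<m) (below-last c top 0<m)
        (labels-distinct c (m<n⇒m<1+n p<m) z<s p≢0)
        (symmetric (subst (λ z → R (v p) (v z)) 1+p≡m (step c (s≤s (≤-reflexive 1+p≡m)))))
        (closing c refl)
      where
      p<m : p < m
      p<m = subst (p <_) 1+p≡m (n<1+n p)
      0<m : 0 < m
      0<m = ≤-<-trans z≤n p<m
      p≢0 : p ≢ 0
      p≢0 = >⇒≢ (s≤s⁻¹ (subst (2 ≤_) (sym 1+p≡m) 2≤m))

  -- The largest (last) vertex cannot end a chord: together with its two
  -- cycle neighbours the chord partner would be a third smaller neighbour.
  no-chord-to-last : ∀ {m v j k} → Cycle (suc m) v → LastOnTop m v →
                     0 < j → j < k → k < m → R (v j) (v m) → ⊥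
  no-chord-to-last {suc m} {v} {j} c top 0<j j<k (s≤s k≤m) r =
    lower-at-most-two (below-last c top (n<1+n m)) (below-last c top z<s)
      (below-last c top (m<n⇒m<1+n j<m))
      (distinct (n<1+n m) z<s (>⇒≢ (<-trans 0<j j<m)))
      (distinct (n<1+n m) (m<n⇒m<1+n j<m) (>⇒≢ j<m))
      (distinct z<s (m<n⇒m<1+n j<m) (<⇒≢ 0<j))
      (symmetric (step c ≤-refl)) (closing c refl) (symmetric r)
    where
    j<m : j < m
    j<m = <-≤-trans j<k k≤m
    distinct : ∀ {p q} → p < suc m → q < suc m → p ≢ q → v p ≢ v q
    distinct p<m q<m = labels-distinct c (m<n⇒m<1+n p<m) (m<n⇒m<1+n q<m)

  NoCrossingUpTo : ℕ → Set
  NoCrossingUpTo t = ∀ {m v} → Cycle m v → Bounded m v t → ¬ Crossing m v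

  top-at-end : ∀ {t m v} → NoCrossingUpTo t → Cycle (suc m) v → Bounded (suc m) v (suc t) →
               v m ≡ suc t → ¬ Crossing (suc m) v
  top-at-end {t} {m} {v} ih c bd vm≡ (crossing i<j j<k k<l l<1+m c₁ c₂)
    with m≤n⇒m<n∨m≡n (s≤s⁻¹ l<1+m)
  ... | inj₁ l<m = ih (delete-last c (last-is-top c bd vm≡) 2≤m) bounded
                      (crossing i<j j<k k<l l<m c₁ c₂)
    where
    2≤m : 2 ≤ m
    2≤m = ≤-trans (≤-trans (s≤s (≤-<-trans z≤n i<j)) j<k) (<⇒≤ (<-trans k<l l<m))
    bounded : Bounded m v t
    bounded {q} q<m = s≤s⁻¹ (subst (v q <_) vm≡ (last-is-top c bd vm≡ q<m))
  ... | inj₂ refl = no-chord-to-last c (last-is-top c bd vm≡) (≤-<-trans z≤n i<j) j<k k<l c₂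

  top-anywhere : ∀ {t m v} → NoCrossingUpTo t → ∀ p → Cycle m v → Bounded m v (suc t) →
                 p < m → v p ≡ suc t → ¬ Crossing m v
  top-anywhere {m = suc m} ih zero c bd (s≤s z≤n) v0≡ x =
    top-at-end ih (rotate-cycle c) (rotate-bounded bd) (trans (rotate-last {p = m} refl) v0≡)
      (rotate-crossing x)
  top-anywhere ih (suc p) c bd 1+p<m vp≡ x =
    top-anywhere ih p (rotate-cycle c) (rotate-bounded bd) (<-trans (n<1+n p) 1+p<m)
      (trans (rotate-inner 1+p<m) vp≡) (rotate-crossing x)

  no-crossing : ∀ t → NoCrossingUpTo t
  no-crossing zero {m} c bd x = <⇒≱ (positive c 0<m) (bd 0<m)
    where
    0<m : 0 < m
    0<m = ≤-<-trans z≤n (Crossing.l<m x)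
  no-crossing (suc t) {m} {v} c bd x with anyUpTo? (λ p → v p ≟ suc t) m
  ... | yes (p , p<m , vp≡) = top-anywhere (no-crossing t) p c bd p<m vp≡ x
  ... | no absent = no-crossing t c smaller x
    where
    smaller : Bounded m v t
    smaller {p} p<m = s≤s⁻¹ (≤∧≢⇒< (bd p<m) (λ vp≡ → absent (p , p<m , vp≡)))

-- (2) Fibonacci estimates

fib-step : ∀ a → fib a ≤ fib (suc a)
fib-step zero          = z≤n
fib-step (suc zero)    = ≤-refl
fib-step (suc (suc a)) = m≤m+n (fib (suc (suc a))) (fib (suc a))

fib-mono : ∀ {a b} → a ≤ b → fib a ≤ fib b
fib-mono = mono′ ∘ ≤⇒≤′
  where
  mono′ : ∀ {a b} → a ≤′ b → fib a ≤ fib b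
  mono′ ≤′-refl            = ≤-refl
  mono′ (≤′-step {b} a≤′b) = ≤-trans (mono′ a≤′b) (fib-step b)

fib-cancel-< : ∀ a b → fib a < fib b → a < b
fib-cancel-< _ _ Fa<Fb = ≰⇒> (λ b≤a → <⇒≱ Fa<Fb (fib-mono b≤a))

fib-double : ∀ a → fib a + fib a ≤ fib (suc (suc a))
fib-double a = +-monoˡ-≤ (fib a) (fib-step a)

fib-window : ∀ {t} a b → t < fib a → fib a < fib b → fib b < t + t → b ≡ suc a
fib-window {t} a b t<Fa Fa<Fb Fb<2t with m≤n⇒m<n∨m≡n (fib-cancel-< a b Fa<Fb)
... | inj₂ 1+a≡b = sym 1+a≡b
... | inj₁ 1+a<b = contradiction
  (≤-<-trans (≤-trans (fib-double a) (fib-mono 1+a<b)) Fb<2t)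
  (<-asym (+-mono-< t<Fa t<Fa))

fib-floor-unique : ∀ {t} a b → fib a ≤ t → t < fib (suc a) → fib b ≤ t → t < fib (suc b) →
                   fib a ≡ fib b
fib-floor-unique a b Fa≤t t<Fa+1 Fb≤t t<Fb+1 with <-cmp (fib a) (fib b)
... | tri≈ _ Fa≡Fb _ = Fa≡Fb
... | tri< Fa<Fb _ _ = contradiction (≤-trans (fib-mono (fib-cancel-< a b Fa<Fb)) Fb≤t) (<⇒≱ t<Fa+1)
... | tri> _ _ Fb<Fa = contradiction (≤-trans (fib-mono (fib-cancel-< b a Fb<Fa)) Fa≤t) (<⇒≱ t<Fb+1)

-- (3) The relation FibRel is 2-simplicial

record Gap (x y : ℕ) : Set where
  constructor mkGap
  field
    gap-index : ℕ
    shift     : x + fib gap-index ≡ y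
    bound     : x + y < fib (suc gap-index)
open Gap

FibRel : ℕ → ℕ → Set
FibRel x y = IsFib (x + y) ⊎ Gap x y ⊎ Gap y x

FibRel-sym : ∀ {x y} → FibRel x y → FibRel y x
FibRel-sym {x} {y} (inj₁ (s , Fs≡x+y)) = inj₁ (s , trans Fs≡x+y (+-comm x y))
FibRel-sym (inj₂ (inj₁ g)) = inj₂ (inj₂ g)
FibRel-sym (inj₂ (inj₂ g)) = inj₂ (inj₁ g)

record SumNeighbour (t y : ℕ) : Set where
  constructor mkSum
  field
    sum-index : ℕ
    sum-eq    : t + y ≡ fib (suc sum-index)
open SumNeighbour

lower-neighbour : ∀ {t y} → Below t y → FibRel t y → SumNeighbour t y ⊎ Gap y t
lower-neighbour {t} {y} (0<y , _) (inj₁ (zero , 0≡t+y)) =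
  contradiction 0≡t+y (<⇒≢ (<-≤-trans 0<y (m≤n+m y t)))
lower-neighbour _ (inj₁ (suc s , Fs≡t+y)) = inj₁ (mkSum s (sym Fs≡t+y))
lower-neighbour {t} (_ , y<t) (inj₂ (inj₁ (mkGap k t+Fk≡y _))) =
  contradiction (≤-trans (m≤m+n t (fib k)) (≤-reflexive t+Fk≡y)) (<⇒≱ y<t)
lower-neighbour _ (inj₂ (inj₂ g)) = inj₂ g

sum-in-window : ∀ {t y} → Below t y → (σ : SumNeighbour t y) →
                t < fib (suc (sum-index σ)) × fib (suc (sum-index σ)) < t + t
sum-in-window {t} (0<y , y<t) (mkSum _ t+y≡F) =
  subst (t <_) t+y≡F (m<m+n t 0<y) , subst (_< t + t) t+y≡F (+-monoʳ-< t y<t)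

sums-consecutive : ∀ {t y₁ y₂} → Below t y₁ → Below t y₂ → y₁ < y₂ →
                   (σ₁ : SumNeighbour t y₁) (σ₂ : SumNeighbour t y₂) →
                   sum-index σ₂ ≡ suc (sum-index σ₁)
sums-consecutive {t} b₁ b₂ y₁<y₂ σ₁@(mkSum s₁ e₁) σ₂@(mkSum s₂ e₂) = suc-injective
  (fib-window (suc s₁) (suc s₂) (proj₁ (sum-in-window b₁ σ₁))
              (subst₂ _<_ e₁ e₂ (+-monoʳ-< t y₁<y₂)) (proj₂ (sum-in-window b₂ σ₂)))

sum-sum-gap : ∀ {t y₁ y₂} → Below t y₁ → Below t y₂ → y₁ < y₂ →
              SumNeighbour t y₁ → SumNeighbour t y₂ → Gap y₁ y₂
sum-sum-gap {t} {y₁} {y₂} b₁ b₂@(_ , y₂<t) y₁<y₂ σ₁@(mkSum s₁ e₁) σ₂@(mkSum s₂ e₂) =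
  mkGap s₁ y₂≡ y₁+y₂<
  where
  y₂≡ : y₁ + fib s₁ ≡ y₂
  y₂≡ = +-cancelˡ-≡ t (y₁ + fib s₁) y₂ (begin
    t + (y₁ + fib s₁)      ≡⟨ sym (+-assoc t y₁ (fib s₁)) ⟩
    t + y₁ + fib s₁        ≡⟨ cong (_+ fib s₁) e₁ ⟩
    fib (suc s₁) + fib s₁  ≡⟨ cong (fib ∘ suc) (sym (sums-consecutive b₁ b₂ y₁<y₂ σ₁ σ₂)) ⟩
    fib (suc s₂)           ≡⟨ sym e₂ ⟩
    t + y₂                 ∎)
  y₁+y₂< : y₁ + y₂ < fib (suc s₁)
  y₁+y₂< = subst (y₁ + y₂ <_) (trans (+-comm y₁ t) e₁) (+-monoʳ-< y₁ y₂<t)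

two-sums-related : ∀ {t y₁ y₂} → Below t y₁ → Below t y₂ → y₁ ≢ y₂ →
                   SumNeighbour t y₁ → SumNeighbour t y₂ → FibRel y₁ y₂
two-sums-related {y₁ = y₁} {y₂} b₁ b₂ y₁≢y₂ σ₁ σ₂ with <-cmp y₁ y₂
... | tri< y₁<y₂ _ _ = inj₂ (inj₁ (sum-sum-gap b₁ b₂ y₁<y₂ σ₁ σ₂))
... | tri≈ _ y₁≡y₂ _ = contradiction y₁≡y₂ y₁≢y₂
... | tri> _ _ y₂<y₁ = inj₂ (inj₂ (sum-sum-gap b₂ b₁ y₂<y₁ σ₂ σ₁))

OneApart : ℕ → ℕ → Set
OneApart a b = b ≡ suc a ⊎ a ≡ suc b

sum-indices-one-apart : ∀ {t y₁ y₂} → Below t y₁ → Below t y₂ → y₁ ≢ y₂ →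
                        (σ₁ : SumNeighbour t y₁) (σ₂ : SumNeighbour t y₂) →
                        OneApart (sum-index σ₁) (sum-index σ₂)
sum-indices-one-apart {y₁ = y₁} {y₂} b₁ b₂ y₁≢y₂ σ₁ σ₂ with <-cmp y₁ y₂
... | tri< y₁<y₂ _ _ = inj₁ (sums-consecutive b₁ b₂ y₁<y₂ σ₁ σ₂)
... | tri≈ _ y₁≡y₂ _ = contradiction y₁≡y₂ y₁≢y₂
... | tri> _ _ y₂<y₁ = inj₂ (sums-consecutive b₂ b₁ y₂<y₁ σ₂ σ₁)

-- Three naturals cannot be pairwise one apart (a parity argument).
no-three-one-apart : ∀ {a b c} → OneApart a b → OneApart a c → OneApart b c → ⊥
no-three-one-apart (inj₁ refl) (inj₁ refl) (inj₁ ())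
no-three-one-apart (inj₁ refl) (inj₁ refl) (inj₂ ())
no-three-one-apart (inj₁ refl) (inj₂ refl) (inj₁ ())
no-three-one-apart (inj₁ refl) (inj₂ refl) (inj₂ ())
no-three-one-apart (inj₂ refl) (inj₁ refl) (inj₁ ())
no-three-one-apart (inj₂ refl) (inj₁ refl) (inj₂ ())
no-three-one-apart (inj₂ refl) (inj₂ refl) (inj₁ ())
no-three-one-apart (inj₂ refl) (inj₂ refl) (inj₂ ())

gap-bracket : ∀ {y t} (g : Gap y t) → fib (gap-index g) ≤ t × t < fib (suc (gap-index g))
gap-bracket {y} {t} (mkGap k y+Fk≡t y+t<) =
  subst (fib k ≤_) y+Fk≡t (m≤n+m (fib k) y) , ≤-<-trans (m≤n+m t y) y+t<

-- t has at most one gap-neighbour: t minus the largest Fibonacci number ≤ t.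
gap-unique : ∀ {y₁ y₂ t} → Gap y₁ t → Gap y₂ t → y₁ ≡ y₂
gap-unique {y₁} {y₂} {t} g₁@(mkGap k₁ y₁+Fk₁≡t _) g₂@(mkGap k₂ y₂+Fk₂≡t _) =
  +-cancelʳ-≡ (fib k₁) y₁ y₂ (begin
    y₁ + fib k₁  ≡⟨ y₁+Fk₁≡t ⟩
    t            ≡⟨ sym y₂+Fk₂≡t ⟩
    y₂ + fib k₂  ≡⟨ cong (y₂ +_) (sym Fk₁≡Fk₂) ⟩
    y₂ + fib k₁  ∎)
  where
  Fk₁≡Fk₂ : fib k₁ ≡ fib k₂
  Fk₁≡Fk₂ = fib-floor-unique k₁ k₂ (proj₁ (gap-bracket g₁)) (proj₂ (gap-bracket g₁))
                                   (proj₁ (gap-bracket g₂)) (proj₂ (gap-bracket g₂))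

-- A smaller sum-neighbour y₁ and a gap-neighbour y₂ = t - F(k) of t:
-- t + y₁ lies strictly between F(k) and F(k+2), so it equals F(k+1).
sum-gap-index : ∀ {t y₁ y₂} → Below t y₁ → 0 < y₂ → (σ : SumNeighbour t y₁) (g : Gap y₂ t) →
                sum-index σ ≡ gap-index g
sum-gap-index {t} {y₁} {y₂} b₁ 0<y₂ σ@(mkSum s _) (mkGap k y₂+Fk≡t y₂+t<) = ≤-antisym s≤k k≤s
  where
  Fk<t : fib k < t
  Fk<t = subst (fib k <_) y₂+Fk≡t (m<n+m (fib k) 0<y₂)
  2t≡ : y₂ + t + fib k ≡ t + t
  2t≡ = begin
    y₂ + t + fib k    ≡⟨ +-assoc y₂ t (fib k) ⟩
    y₂ + (t + fib k)  ≡⟨ cong (y₂ +_) (+-comm t (fib k)) ⟩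
    y₂ + (fib k + t)  ≡⟨ sym (+-assoc y₂ (fib k) t) ⟩
    y₂ + fib k + t    ≡⟨ cong (_+ t) y₂+Fk≡t ⟩
    t + t             ∎
  2t<Fk+2 : t + t < fib (suc (suc k))
  2t<Fk+2 = subst (_< fib (suc (suc k))) 2t≡ (+-monoˡ-< (fib k) y₂+t<)
  k≤s : k ≤ s
  k≤s = s≤s⁻¹ (fib-cancel-< k (suc s) (<-trans Fk<t (proj₁ (sum-in-window b₁ σ))))
  s≤k : s ≤ k
  s≤k = s≤s⁻¹ (s≤s⁻¹ (fib-cancel-< (suc s) (suc (suc k))
                        (<-trans (proj₂ (sum-in-window b₁ σ)) 2t<Fk+2)))

-- ... hence y₁ + y₂ = F(k+1) - F(k) = F(k-1) is a Fibonacci number.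
sum-gap-fib : ∀ {t y₁ y₂} → Below t y₁ → 0 < y₂ → SumNeighbour t y₁ → Gap y₂ t →
              IsFib (y₁ + y₂)
sum-gap-fib {t} {y₁} {y₂} b₁@(0<y₁ , y₁<t) 0<y₂ σ g =
  fib-difference (gap-index g) (subst (λ s → t + y₁ ≡ fib (suc s)) (sum-gap-index b₁ 0<y₂ σ g) (sum-eq σ))
    (shift g)
  where
  fib-difference : ∀ k → t + y₁ ≡ fib (suc k) → y₂ + fib k ≡ t → IsFib (y₁ + y₂)
  fib-difference zero t+y₁≡1 _ =
    contradiction (subst (2 ≤_) t+y₁≡1 (≤-trans (≤-trans (s≤s 0<y₁) y₁<t) (m≤m+n t y₁)))
                  λ { (s≤s ()) }
  fib-difference (suc k) t+y₁≡ y₂+Fk+1≡t =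
    k , sym (+-cancelʳ-≡ (fib (suc k)) (y₁ + y₂) (fib k) (begin
      y₁ + y₂ + fib (suc k)    ≡⟨ +-assoc y₁ y₂ (fib (suc k)) ⟩
      y₁ + (y₂ + fib (suc k))  ≡⟨ cong (y₁ +_) y₂+Fk+1≡t ⟩
      y₁ + t                   ≡⟨ +-comm y₁ t ⟩
      t + y₁                   ≡⟨ t+y₁≡ ⟩
      fib (suc k) + fib k      ≡⟨ +-comm (fib (suc k)) (fib k) ⟩
      fib k + fib (suc k)      ∎))

-- Two different smaller sum-neighbours exclude a gap-neighbour: both would
-- equal F(k+1) - t.
two-sums-one-gap : ∀ {t y₁ y₂ y₃} → Below t y₁ → Below t y₂ → 0 < y₃ → y₁ ≢ y₂ →
                   SumNeighbour t y₁ → SumNeighbour t y₂ → Gap y₃ t → ⊥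
two-sums-one-gap {t} {y₁} {y₂} b₁ b₂ 0<y₃ y₁≢y₂ σ₁@(mkSum s₁ e₁) σ₂@(mkSum s₂ e₂) g =
  y₁≢y₂ (+-cancelˡ-≡ t y₁ y₂ (begin
    t + y₁        ≡⟨ e₁ ⟩
    fib (suc s₁)  ≡⟨ cong (fib ∘ suc) s₁≡s₂ ⟩
    fib (suc s₂)  ≡⟨ sym e₂ ⟩
    t + y₂        ∎))
  where
  s₁≡s₂ : s₁ ≡ s₂
  s₁≡s₂ = trans (sum-gap-index b₁ 0<y₃ σ₁ g) (sym (sum-gap-index b₂ 0<y₃ σ₂ g))

fib-lower-adjacent : ∀ {t y₁ y₂} → Below t y₁ → Below t y₂ → y₁ ≢ y₂ →
                     FibRel t y₁ → FibRel t y₂ → FibRel y₁ y₂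
fib-lower-adjacent b₁ b₂ y₁≢y₂ r₁ r₂ with lower-neighbour b₁ r₁ | lower-neighbour b₂ r₂
... | inj₁ σ₁ | inj₁ σ₂ = two-sums-related b₁ b₂ y₁≢y₂ σ₁ σ₂
... | inj₁ σ₁ | inj₂ g₂ = inj₁ (sum-gap-fib b₁ (proj₁ b₂) σ₁ g₂)
... | inj₂ g₁ | inj₁ σ₂ = FibRel-sym (inj₁ (sum-gap-fib b₂ (proj₁ b₁) σ₂ g₁))
... | inj₂ g₁ | inj₂ g₂ = contradiction (gap-unique g₁ g₂) y₁≢y₂

fib-lower-at-most-two : ∀ {t y₁ y₂ y₃} → Below t y₁ → Below t y₂ → Below t y₃ →
                        y₁ ≢ y₂ → y₁ ≢ y₃ → y₂ ≢ y₃ →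
                        FibRel t y₁ → FibRel t y₂ → FibRel t y₃ → ⊥
fib-lower-at-most-two b₁ b₂ b₃ y₁≢y₂ y₁≢y₃ y₂≢y₃ r₁ r₂ r₃
  with lower-neighbour b₁ r₁ | lower-neighbour b₂ r₂ | lower-neighbour b₃ r₃
... | inj₁ σ₁ | inj₁ σ₂ | inj₁ σ₃ =
  no-three-one-apart (sum-indices-one-apart b₁ b₂ y₁≢y₂ σ₁ σ₂)
                     (sum-indices-one-apart b₁ b₃ y₁≢y₃ σ₁ σ₃)
                     (sum-indices-one-apart b₂ b₃ y₂≢y₃ σ₂ σ₃)
... | inj₁ σ₁ | inj₁ σ₂ | inj₂ g₃ = two-sums-one-gap b₁ b₂ (proj₁ b₃) y₁≢y₂ σ₁ σ₂ g₃
... | inj₁ σ₁ | inj₂ g₂ | inj₁ σ₃ = two-sums-one-gap b₁ b₃ (proj₁ b₂) y₁≢y₃ σ₁ σ₃ g₂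
... | inj₂ g₁ | inj₁ σ₂ | inj₁ σ₃ = two-sums-one-gap b₂ b₃ (proj₁ b₁) y₂≢y₃ σ₂ σ₃ g₁
... | _       | inj₂ g₂ | inj₂ g₃ = y₂≢y₃ (gap-unique g₂ g₃)
... | inj₂ g₁ | _       | inj₂ g₃ = y₁≢y₃ (gap-unique g₁ g₃)
... | inj₂ g₁ | inj₂ g₂ | _       = y₁≢y₂ (gap-unique g₁ g₂)

fibRel-simplicial : TwoSimplicial FibRel
fibRel-simplicial = record
  { symmetric         = FibRel-sym
  ; lower-adjacent    = fib-lower-adjacent
  ; lower-at-most-two = fib-lower-at-most-two
  }

open Elimination fibRel-simplicial

-- (4) Transfer to the cycles of Defs, and the theorem

-- A Fin-indexed labelling read as a labelling of ℕ (0 beyond position m-1).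
extend : ∀ {m} → (Fin m → ℕ) → ℕ → ℕ
extend {m} a p with p <? m
... | yes p<m = a (fromℕ< p<m)
... | no _    = 0

extend-fromℕ< : ∀ {m} (a : Fin m → ℕ) {p} (p<m : p < m) → extend a p ≡ a (fromℕ< p<m)
extend-fromℕ< {m} a {p} p<m with p <? m
... | yes p<m′ = cong a (fromℕ<-cong p p refl p<m′ p<m)
... | no p≮m  = contradiction p<m p≮m

extend-toℕ : ∀ {m} (a : Fin m → ℕ) (f : Fin m) → extend a (toℕ f) ≡ a f
extend-toℕ a f = trans (extend-fromℕ< a (toℕ<n f)) (cong a (fromℕ<-toℕ f (toℕ<n f)))

adj⇒fibRel : ∀ {n x y} → Adj n x y → FibRel x y
adj⇒fibRel (_ , _ , _ , x+y-fib) = inj₁ x+y-fib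

module FromIsCycle {n m : ℕ} {a : Fin m → ℕ} (cyc : IsCycle n m a) where
  open IsCycle cyc

  step-adj : ∀ {p} → suc p < m → Adj n (extend a p) (extend a (suc p))
  step-adj {p} 1+p<m =
    subst₂ (Adj n) (sym (extend-fromℕ< a p<m)) (sym (extend-fromℕ< a 1+p<m))
      (consec _ _ (trans (cong suc (toℕ-fromℕ< p<m)) (sym (toℕ-fromℕ< 1+p<m))))
    where
    p<m : p < m
    p<m = <-trans (n<1+n p) 1+p<m

  closing-adj : ∀ {p} → suc p ≡ m → Adj n (extend a p) (extend a 0)
  closing-adj {p} 1+p≡m =
    subst₂ (Adj n) (sym (extend-fromℕ< a p<m)) (sym (extend-fromℕ< a 0<m))
      (closing _ _ (trans (cong suc (toℕ-fromℕ< p<m)) 1+p≡m) (toℕ-fromℕ< 0<m))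
    where
    p<m : p < m
    p<m = subst (p <_) 1+p≡m (n<1+n p)
    0<m : 0 < m
    0<m = ≤-<-trans z≤n p<m

  -- Every position starts an edge of the cycle, so its label lies in 1 … n.
  in-range : ∀ {p} → p < m → 1 ≤ extend a p × extend a p ≤ n
  in-range p<m with m≤n⇒m<n∨m≡n p<m
  ... | inj₁ 1+p<m = proj₁ (step-adj 1+p<m)
  ... | inj₂ 1+p≡m = proj₁ (closing-adj 1+p≡m)

  fib-cycle : Cycle m (extend a)
  fib-cycle = record
    { positive  = proj₁ ∘ in-range
    ; injective = injective′
    ; step      = adj⇒fibRel ∘ step-adj
    ; closing   = adj⇒fibRel ∘ closing-adj
    }
    where
    injective′ : ∀ {p q} → p < m → q < m → extend a p ≡ extend a q → p ≡ q
    injective′ {p} {q} p<m q<m e = begin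
      p                    ≡⟨ sym (toℕ-fromℕ< p<m) ⟩
      toℕ (fromℕ< p<m)     ≡⟨ cong toℕ (distinct _ _ a-eq) ⟩
      toℕ (fromℕ< q<m)     ≡⟨ toℕ-fromℕ< q<m ⟩
      q                    ∎
      where
      a-eq : a (fromℕ< p<m) ≡ a (fromℕ< q<m)
      a-eq = trans (sym (extend-fromℕ< a p<m)) (trans e (extend-fromℕ< a q<m))

  fib-bounded : Bounded m (extend a) n
  fib-bounded = proj₂ ∘ in-range

theorem10 : ∀ (n : ℕ) → 7 ≤ n → ∀ (m : ℕ) (a : Fin m → ℕ) → IsCycle n m a →
    ¬ (∃ λ i → ∃ λ j → ∃ λ k → ∃ λ l →
        (i <ᶠ j × j <ᶠ k × k <ᶠ l) × Adj n (a i) (a k) × Adj n (a j) (a l))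
theorem10 n _ m a cyc (i , j , k , l , (i<j , j<k , k<l) , a-ik , a-jl) =
  no-crossing n fib-cycle fib-bounded
    (crossing i<j j<k k<l (toℕ<n l) (chord a-ik) (chord a-jl))
  where
  open FromIsCycle cyc
  chord : ∀ {x y} → Adj n (a x) (a y) → FibRel (extend a (toℕ x)) (extend a (toℕ y))
  chord = adj⇒fibRel ∘ subst₂ (Adj n) (sym (extend-toℕ a _)) (sym (extend-toℕ a _))
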